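{- There exist an absolute constant $c>0$ and $m_0$ such that for all $m\ge m_0$ and all positive integers $k<0.99m$, the function $\mathrm{DISJ}^m_k$ has a $\left(\frac{1}{10},\lfloor ck\rfloor\right)$-hitting distribution over $0$-monochromatic rectangles.
   Context: $\binom{[m]}{k}$ denotes the set of $k$-element subsets of $[m]=\{1,\dots,m\}$. $\mathrm{DISJ}^m_k:\binom{[m]}{k}\times\binom{[m]}{k}\to\{0,1\}$ is given by $\mathrm{DISJ}^m_k(a,b)=1$ if $a\cap b=\varnothing$ and $0$ otherwise. A rectangle is $U\times V$ with $U,V\subseteq\binom{[m]}{k}$; it is $b$-monochromatic if the function equals $b$ on all of it. A probability distribution $\mu$ over rectangles is $(\delta,h)$-hitting if for all $X,Y\subseteq\binom{[m]}{k}$ with $|X|,|Y|\ge 2^{ -h}\binom{m}{k}$ we have $\Pr_{R\sim\mu}[R\cap(X\times Y)\ne\varnothing]\ge 1-\delta$ (this definition is used also when $h=0$). -}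

module Defs where

open import Data.Bool using (Bool; true; false; _∧_; if_then_else_)
open import Data.Nat using (ℕ; zero; suc; _*_; _^_; _≤_)
open import Data.Nat.Combinatorics using (_C_)
open import Data.Fin.Subset using (Subset; ∣_∣; _∩_; Nonempty; inside; outside)
open import Data.Fin.Subset.Properties using (nonempty?)
open import Data.List using (List; []; _∷_; map; _++_)
open import Data.Nat.ListAction using (sum)
open import Data.Bool.ListAction using (any)
open import Data.List.Relation.Unary.All using (All)
open import Data.Vec using ([]; _∷_)
open import Data.Product using (_×_; _,_)
open import Data.Rational as ℚ using (ℚ; 0ℚ; 1ℚ)
open import Relation.Nullary.Decidable using (does)
open import Relation.Binary.PropositionalEquality using (_≡_)

allSubsets : (m : ℕ) → List (Subset m)
allSubsets zero = [] ∷ []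
allSubsets (suc m) = map (outside ∷_) (allSubsets m) ++ map (inside ∷_) (allSubsets m)

DISJ : ∀ {m} → Subset m → Subset m → ℕ
DISJ a b = if does (nonempty? (a ∩ b)) then 0 else 1

Family : ℕ → Set
Family m = Subset m → Bool

IsKFamily : ∀ {m} → ℕ → Family m → Set
IsKFamily k F = ∀ s → F s ≡ true → ∣ s ∣ ≡ k

size : ∀ {m} → Family m → ℕ
size {m} F = sum (map (λ s → if F s then 1 else 0) (allSubsets m))

Rectangle : ℕ → Set
Rectangle m = Family m × Family m

-- (U × V) ∩ (X × Y) ≠ ∅  iff  U ∩ X ≠ ∅ and V ∩ Y ≠ ∅.
meets : ∀ {m} → Rectangle m → Family m → Family m → Bool
meets {m} (U , V) X Y =
  any (λ a → U a ∧ X a) (allSubsets m) ∧ any (λ b → V b ∧ Y b) (allSubsets m)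

Dist : ℕ → Set
Dist m = List (ℚ × Rectangle m)

totalWeight : ∀ {m} → Dist m → ℚ
totalWeight [] = 0ℚ
totalWeight ((w , _) ∷ D) = w ℚ.+ totalWeight D

IsProbDist : ∀ {m} → Dist m → Set
IsProbDist D = All (λ e → 0ℚ ℚ.≤ Data.Product.proj₁ e) D × totalWeight D ≡ 1ℚ
  where import Data.Product

probMeets : ∀ {m} → Dist m → Family m → Family m → ℚ
probMeets [] X Y = 0ℚ
probMeets ((w , R) ∷ D) X Y =
  (if meets R X Y then w else 0ℚ) ℚ.+ probMeets D X Y

IsZeroMonoRect : ∀ {m} → ℕ → Rectangle m → Set
IsZeroMonoRect k (U , V) =
  IsKFamily k U × IsKFamily k V ×
  (∀ a b → U a ≡ true → V b ≡ true → DISJ a b ≡ 0)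

OverZeroMono : ∀ {m} → ℕ → Dist m → Set
OverZeroMono k D = All (λ e → IsZeroMonoRect k (Data.Product.proj₂ e)) D
  where import Data.Product

IsHitting : (m k : ℕ) → ℚ → ℕ → Dist m → Set
IsHitting m k δ h D =
  ∀ (X Y : Family m) → IsKFamily k X → IsKFamily k Y →
  m C k ≤ 2 ^ h * size X → m C k ≤ 2 ^ h * size Y →
  1ℚ ℚ.- δ ℚ.≤ probMeets D X Y

-- Let μ be uniform over the m rectangles Sᵢ × Sᵢ, where Sᵢ is the family of k-sets containing i;
-- each is 0-monochromatic because any two members of Sᵢ share i.  Sᵢ × Sᵢ meets X × Y iff i lies
-- in both ⋃X and ⋃Y.  If u = |⋃X| then |X| ≤ C(u,k) and C(u,k) m^k ≤ C(m,k) u^k, so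
-- |X| ≥ 2^(-h) C(m,k) gives m^k ≤ 2^h u^k.  Taking c = 1/14, so that 14h ≤ k, the numerical fact
-- 2 · 19^14 ≤ 20^14 turns this into 19m ≤ 20u.  Hence ⋃X and ⋃Y each miss at most m/20 points,
-- and μ hits X × Y with probability |⋃X ∩ ⋃Y|/m ≥ 9/10.  Any m₀ ≥ 1 works, and k < 0.99m is only
-- used in the form k ≤ m.

module Submission where

open import Defs
open import Function using (_∘_; Equivalence)
open import Data.Nat using (ℕ; zero; suc; _+_; _*_; _∸_; _^_; _!; _≤_; _<_; _≡ᵇ_; _≤?_; z≤n; s≤s; NonZero; >-nonZero)
import Data.Nat as ℕ
open import Data.Nat.Properties
open import Data.Nat.Combinatorics using (_C_; nCk+nC[k+1]≡[n+1]C[k+1]; k>n⇒nCk≡0)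
open import Data.Nat.Combinatorics.Base using (_P′_)
open import Data.Nat.Combinatorics.Specification using (nCk≡n!/k![n-k]!; nC′k≡n!/k![n-k]!; k!∣nP′k)
open import Data.Nat.DivMod using (m/n*n≡m; m/n*n≤m)
open import Data.Nat.ListAction using (sum)
open import Data.Nat.ListAction.Properties using (sum-++)
open import Data.Nat.Tactic.RingSolver using (solve-∀)
open import Data.Integer as ℤ using (+_; -[1+_]; +≤+)
import Data.Integer.Properties as ℤ
open import Data.Integer.DivMod using (div-pos-is-/ℕ)
open import Data.Rational as ℚ using (ℚ; Positive; mkℚ; _/_; toℚᵘ; floor; 1ℚ)
import Data.Rational.Properties as ℚ
open import Data.Rational.Unnormalised as ℚᵘ using (mkℚᵘ; *≡*; *≤*)
import Data.Rational.Unnormalised.Properties as ℚᵘ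
open import Data.Bool using (Bool; true; false; _∧_; if_then_else_)
open import Data.Bool.Properties using (∧-zeroʳ; ∧-conicalˡ; ∧-conicalʳ; T-≡)
open import Data.Bool.ListAction using (any)
open import Data.Fin using (Fin; zero; suc)
open import Data.Fin.Subset using (Subset; ∣_∣; _∩_; _⊆_; _∈_; inside; outside)
open import Data.Fin.Subset.Properties using (_⊆?_; nonempty?; x∈p∩q⁺; ∣p∣≤n)
open import Data.List using (List; []; _∷_; map; _++_)
import Data.List as List
open import Data.List.Properties using (map-++; map-∘)
open import Data.List.Relation.Unary.All.Properties using (tabulate⁺)
open import Data.List.Relation.Unary.Any using (here)
open import Data.List.Relation.Unary.Any.Properties using (any⁺)
import Data.List.Membership.Propositional as List
open import Data.List.Membership.Propositional.Properties using (∈-map⁺; ∈-++⁺ˡ; ∈-++⁺ʳ)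
open import Data.Vec using ([]; _∷_; lookup; tabulate)
open import Data.Vec.Properties using (lookup∘tabulate; lookup⇒[]=; []=⇒lookup; lookup-zipWith; tabulate-cong; tabulate∘lookup)
open import Data.Product using (Σ; _×_; _,_)
open import Relation.Binary.PropositionalEquality
open import Relation.Nullary using (yes; no; does; contradiction)
open import Relation.Nullary.Decidable using (dec-true)

nP′k≡0 : ∀ {n k} → n < k → n P′ k ≡ 0
nP′k≡0 {n} {suc k} (s≤s n≤k) = cong (_* (n P′ k)) (m≤n⇒m∸n≡0 n≤k)

nCk*k!≡nP′k : ∀ n k → (n C k) * k ! ≡ n P′ k
nCk*k!≡nP′k n k with k ≤? n
... | yes k≤n = begin
  (n C k) * k !           ≡⟨ cong (_* k !) (trans (nCk≡n!/k![n-k]! k≤n) (sym (nC′k≡n!/k![n-k]! k≤n))) ⟩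
  (n P′ k) ℕ./ k ! * k !  ≡⟨ m/n*n≡m (k!∣nP′k k≤n) ⟩
  n P′ k                  ∎
  where open ≡-Reasoning; instance _ = k !≢0
... | no k≰n = trans (cong (_* k !) (k>n⇒nCk≡0 (≰⇒> k≰n))) (sym (nP′k≡0 (≰⇒> k≰n)))

nCk>0 : ∀ {n k} → k ≤ n → 0 < n C k
nCk>0 {k = zero} _ = s≤s z≤n
nCk>0 {suc n} {suc k} (s≤s k≤n) =
  subst (0 <_) (nCk+nC[k+1]≡[n+1]C[k+1] n k) (≤-trans (nCk>0 k≤n) (m≤m+n _ _))

[u∸j]*m≤[m∸j]*u : ∀ {u m} j → u ≤ m → (u ∸ j) * m ≤ (m ∸ j) * u
[u∸j]*m≤[m∸j]*u {u} {m} j u≤m = begin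
  (u ∸ j) * m    ≡⟨ *-distribʳ-∸ m u j ⟩
  u * m ∸ j * m  ≤⟨ ∸-monoʳ-≤ (u * m) (*-monoʳ-≤ j u≤m) ⟩
  u * m ∸ j * u  ≡⟨ cong (_∸ j * u) (*-comm u m) ⟩
  m * u ∸ j * u  ≡⟨ *-distribʳ-∸ u m j ⟨
  (m ∸ j) * u    ∎
  where open ≤-Reasoning

uP′k*m^k≤mP′k*u^k : ∀ {u m} k → u ≤ m → (u P′ k) * m ^ k ≤ (m P′ k) * u ^ k
uP′k*m^k≤mP′k*u^k zero u≤m = ≤-refl
uP′k*m^k≤mP′k*u^k {u} {m} (suc k) u≤m = begin
  (u ∸ k) * (u P′ k) * (m * m ^ k)     ≡⟨ interchange (u ∸ k) (u P′ k) m (m ^ k) ⟩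
  (u ∸ k) * m * ((u P′ k) * m ^ k)     ≤⟨ *-mono-≤ ([u∸j]*m≤[m∸j]*u k u≤m) (uP′k*m^k≤mP′k*u^k k u≤m) ⟩
  (m ∸ k) * u * ((m P′ k) * u ^ k)     ≡⟨ interchange (m ∸ k) (m P′ k) u (u ^ k) ⟨
  (m ∸ k) * (m P′ k) * (u * u ^ k)     ∎
  where
  open ≤-Reasoning
  interchange : ∀ a b c d → a * b * (c * d) ≡ a * c * (b * d)
  interchange = solve-∀

uCk*m^k≤mCk*u^k : ∀ {u m} k → u ≤ m → (u C k) * m ^ k ≤ (m C k) * u ^ k
uCk*m^k≤mCk*u^k {u} {m} k u≤m = *-cancelʳ-≤ _ _ (k !) (begin
  (u C k) * m ^ k * k !   ≡⟨ swap (u C k) (m ^ k) (k !) ⟩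
  (u C k) * k ! * m ^ k   ≡⟨ cong (_* m ^ k) (nCk*k!≡nP′k u k) ⟩
  (u P′ k) * m ^ k        ≤⟨ uP′k*m^k≤mP′k*u^k k u≤m ⟩
  (m P′ k) * u ^ k        ≡⟨ cong (_* u ^ k) (nCk*k!≡nP′k m k) ⟨
  (m C k) * k ! * u ^ k   ≡⟨ swap (m C k) (u ^ k) (k !) ⟨
  (m C k) * u ^ k * k !   ∎)
  where
  open ≤-Reasoning
  instance _ = k !≢0
  swap : ∀ a b c → a * b * c ≡ a * c * b
  swap = solve-∀

[m*n]^k≡m^k*n^k : ∀ m n k → (m * n) ^ k ≡ m ^ k * n ^ k
[m*n]^k≡m^k*n^k m n zero = refl
[m*n]^k≡m^k*n^k m n (suc k) = begin
  m * n * (m * n) ^ k          ≡⟨ cong (m * n *_) ([m*n]^k≡m^k*n^k m n k) ⟩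
  m * n * (m ^ k * n ^ k)      ≡⟨ interchange m n (m ^ k) (n ^ k) ⟩
  m * m ^ k * (n * n ^ k)      ∎
  where
  open ≡-Reasoning
  interchange : ∀ a b c d → a * b * (c * d) ≡ a * c * (b * d)
  interchange = solve-∀

^-cancelˡ-≤ : ∀ {m n} k .{{_ : NonZero k}} → m ^ k ≤ n ^ k → m ≤ n
^-cancelˡ-≤ {m} {n} k m^k≤n^k with m ≤? n
... | yes m≤n = m≤n
... | no m≰n = contradiction m^k≤n^k (<⇒≱ (^-monoˡ-< k (≰⇒> m≰n)))

2^h*a^k≤b^k : ∀ {a b d} h k → a ≤ b → 2 * a ^ d ≤ b ^ d → d * h ≤ k → 2 ^ h * a ^ k ≤ b ^ k
2^h*a^k≤b^k {a} {b} {d} h k a≤b 2a^d≤b^d dh≤k with m≤n⇒∃[o]m+o≡n dh≤k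
... | r , refl = begin
  2 ^ h * a ^ (d * h + r)         ≡⟨ cong (2 ^ h *_) (split a) ⟩
  2 ^ h * ((a ^ d) ^ h * a ^ r)   ≡⟨ *-assoc (2 ^ h) _ _ ⟨
  2 ^ h * (a ^ d) ^ h * a ^ r     ≡⟨ cong (_* a ^ r) ([m*n]^k≡m^k*n^k 2 (a ^ d) h) ⟨
  (2 * a ^ d) ^ h * a ^ r         ≤⟨ *-mono-≤ (^-monoˡ-≤ h 2a^d≤b^d) (^-monoˡ-≤ r a≤b) ⟩
  (b ^ d) ^ h * b ^ r             ≡⟨ split b ⟨
  b ^ (d * h + r)                 ∎
  where
  open ≤-Reasoning
  split : ∀ x → x ^ (d * h + r) ≡ (x ^ d) ^ h * x ^ r
  split x = trans (^-distribˡ-+-* x (d * h) r) (cong (_* x ^ r) (sym (^-*-assoc x d h)))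

m^k≤2^h*u^k : ∀ {m u k} h → k ≤ m → u ≤ m → m C k ≤ 2 ^ h * (u C k) → m ^ k ≤ 2 ^ h * u ^ k
m^k≤2^h*u^k {m} {u} {k} h k≤m u≤m mCk≤2^h*uCk = *-cancelˡ-≤ (m C k) (begin
  (m C k) * m ^ k              ≤⟨ *-monoˡ-≤ (m ^ k) mCk≤2^h*uCk ⟩
  2 ^ h * (u C k) * m ^ k      ≡⟨ *-assoc (2 ^ h) (u C k) (m ^ k) ⟩
  2 ^ h * ((u C k) * m ^ k)    ≤⟨ *-monoʳ-≤ (2 ^ h) (uCk*m^k≤mCk*u^k k u≤m) ⟩
  2 ^ h * ((m C k) * u ^ k)    ≡⟨ x*[y*z]≡y*[x*z] (2 ^ h) (m C k) (u ^ k) ⟩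
  (m C k) * (2 ^ h * u ^ k)    ∎)
  where
  open ≤-Reasoning
  instance _ = >-nonZero (nCk>0 k≤m)
  x*[y*z]≡y*[x*z] : ∀ x y z → x * (y * z) ≡ y * (x * z)
  x*[y*z]≡y*[x*z] = solve-∀

19m≤20u : ∀ {m u k} h → 0 < k → 14 * h ≤ k → m ^ k ≤ 2 ^ h * u ^ k → 19 * m ≤ 20 * u
19m≤20u {m} {u} {k} h 0<k 14h≤k m^k≤2^h*u^k = ^-cancelˡ-≤ k (begin
  (19 * m) ^ k                ≡⟨ [m*n]^k≡m^k*n^k 19 m k ⟩
  19 ^ k * m ^ k              ≤⟨ *-monoʳ-≤ (19 ^ k) m^k≤2^h*u^k ⟩
  19 ^ k * (2 ^ h * u ^ k)    ≡⟨ x*[y*z]≡[y*x]*z (19 ^ k) (2 ^ h) (u ^ k) ⟩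
  2 ^ h * 19 ^ k * u ^ k      ≤⟨ *-monoˡ-≤ (u ^ k) (2^h*a^k≤b^k {d = 14} h k (≤ᵇ⇒≤ 19 20 _) (≤ᵇ⇒≤ (2 * 19 ^ 14) (20 ^ 14) _) 14h≤k) ⟩
  20 ^ k * u ^ k              ≡⟨ [m*n]^k≡m^k*n^k 20 u k ⟨
  (20 * u) ^ k                ∎)
  where
  open ≤-Reasoning
  instance _ = >-nonZero 0<k
  x*[y*z]≡[y*x]*z : ∀ x y z → x * (y * z) ≡ y * x * z
  x*[y*z]≡[y*x]*z = solve-∀

count : ∀ {A : Set} → (A → Bool) → List A → ℕ
count p xs = sum (map (λ x → if p x then 1 else 0) xs)

count-mono : ∀ {A : Set} {p q : A → Bool} → (∀ x → p x ≡ true → q x ≡ true) →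
             ∀ xs → count p xs ≤ count q xs
count-mono p⇒q [] = z≤n
count-mono {p = p} {q} p⇒q (x ∷ xs) = +-mono-≤ (if-mono (p x) (q x) (p⇒q x)) (count-mono p⇒q xs)
  where
  if-mono : ∀ b c → (b ≡ true → c ≡ true) → (if b then 1 else 0) ≤ (if c then 1 else 0)
  if-mono false c _ = z≤n
  if-mono true c b⇒c rewrite b⇒c refl = ≤-refl

count-none : ∀ {A : Set} {p : A → Bool} → (∀ x → p x ≡ false) → ∀ xs → count p xs ≡ 0
count-none p≡false [] = refl
count-none p≡false (x ∷ xs) rewrite p≡false x = count-none p≡false xs

size-none : ∀ {m} (F : Family m) → (∀ s → F s ≡ false) → size F ≡ 0
size-none {m} F F≡false = count-none F≡false (allSubsets m)

size-suc : ∀ {m} (F : Family (suc m)) → size F ≡ size (F ∘ (outside ∷_)) + size (F ∘ (inside ∷_))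
size-suc {m} F = begin
  count F (map (outside ∷_) all ++ map (inside ∷_) all)
    ≡⟨ cong sum (map-++ _ (map (outside ∷_) all) (map (inside ∷_) all)) ⟩
  sum (map _ (map (outside ∷_) all) ++ map _ (map (inside ∷_) all))
    ≡⟨ sum-++ (map _ (map (outside ∷_) all)) _ ⟩
  sum (map _ (map (outside ∷_) all)) + sum (map _ (map (inside ∷_) all))
    ≡⟨ cong₂ _+_ (cong sum (map-∘ all)) (cong sum (map-∘ all)) ⟨
  size (F ∘ (outside ∷_)) + size (F ∘ (inside ∷_)) ∎
  where
  open ≡-Reasoning
  all = allSubsets m

kSubsetsOf : ∀ {m} → Subset m → ℕ → Family m
kSubsetsOf S k s = (∣ s ∣ ≡ᵇ k) ∧ does (s ⊆? S)

size-kSubsetsOf : ∀ {m} (S : Subset m) k → size (kSubsetsOf S k) ≡ ∣ S ∣ C k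
size-kSubsetsOf [] zero = refl
size-kSubsetsOf [] (suc k) = refl
size-kSubsetsOf (outside ∷ S) k = begin
  size (kSubsetsOf (outside ∷ S) k)   ≡⟨ size-suc (kSubsetsOf (outside ∷ S) k) ⟩
  size (kSubsetsOf S k) + _           ≡⟨ cong (_+_ (size (kSubsetsOf S k))) (size-none (kSubsetsOf (outside ∷ S) k ∘ (inside ∷_)) (λ s → ∧-zeroʳ _)) ⟩
  size (kSubsetsOf S k) + 0           ≡⟨ +-identityʳ _ ⟩
  size (kSubsetsOf S k)               ≡⟨ size-kSubsetsOf S k ⟩
  ∣ S ∣ C k                           ∎
  where open ≡-Reasoning
size-kSubsetsOf (inside ∷ S) zero = trans (size-suc (kSubsetsOf (inside ∷ S) zero))
  (cong₂ _+_ (size-kSubsetsOf S zero) (size-none (kSubsetsOf (inside ∷ S) zero ∘ (inside ∷_)) (λ _ → refl)))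
size-kSubsetsOf (inside ∷ S) (suc k) = begin
  size (kSubsetsOf (inside ∷ S) (suc k))                 ≡⟨ size-suc (kSubsetsOf (inside ∷ S) (suc k)) ⟩
  size (kSubsetsOf S (suc k)) + size (kSubsetsOf S k)    ≡⟨ cong₂ _+_ (size-kSubsetsOf S (suc k)) (size-kSubsetsOf S k) ⟩
  ∣ S ∣ C suc k + ∣ S ∣ C k                              ≡⟨ +-comm (∣ S ∣ C suc k) _ ⟩
  ∣ S ∣ C k + ∣ S ∣ C suc k                              ≡⟨ nCk+nC[k+1]≡[n+1]C[k+1] ∣ S ∣ k ⟩
  suc ∣ S ∣ C suc k                                      ∎
  where open ≡-Reasoning

∈-allSubsets : ∀ {m} (s : Subset m) → s List.∈ allSubsets m
∈-allSubsets [] = here refl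
∈-allSubsets (outside ∷ s) = ∈-++⁺ˡ (∈-map⁺ (outside ∷_) (∈-allSubsets s))
∈-allSubsets {suc m} (inside ∷ s) =
  ∈-++⁺ʳ (map (outside ∷_) (allSubsets m)) (∈-map⁺ (inside ∷_) (∈-allSubsets s))

any-allSubsets : ∀ {m} (p : Subset m → Bool) s → p s ≡ true → any p (allSubsets m) ≡ true
any-allSubsets p s ps = Equivalence.to T-≡
  (any⁺ p (List.lose (∈-allSubsets s) (Equivalence.from T-≡ ps)))

star : ∀ {m} → ℕ → Fin m → Family m
star k i a = lookup a i ∧ (∣ a ∣ ≡ᵇ k)

starRect : ∀ {m} → ℕ → Fin m → Rectangle m
starRect k i = star k i , star k i

-- ⋃X, phrased through star k so that it matches the unfolding of meets on starRect k i.
cover : ∀ {m} → ℕ → Family m → Subset m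
cover {m} k X = tabulate λ i → any (λ a → star k i a ∧ X a) (allSubsets m)

∣s∣≡ᵇk : ∀ {m k} {X : Family m} → IsKFamily k X → ∀ {s} → X s ≡ true → (∣ s ∣ ≡ᵇ k) ≡ true
∣s∣≡ᵇk {k = k} kX {s} Xs = Equivalence.to T-≡ (≡⇒≡ᵇ ∣ s ∣ k (kX s Xs))

⊆-cover : ∀ {m k} {X : Family m} {s} → IsKFamily k X → X s ≡ true → s ⊆ cover k X
⊆-cover {k = k} {X} {s} kX Xs {i} i∈s = lookup⇒[]= i (cover k X)
  (trans (lookup∘tabulate _ i) (any-allSubsets (λ a → star k i a ∧ X a) s
    (cong₂ _∧_ (cong₂ _∧_ ([]=⇒lookup i∈s) (∣s∣≡ᵇk kX Xs)) Xs)))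

size≤∣cover∣Ck : ∀ {m k} {X : Family m} → IsKFamily k X → size X ≤ ∣ cover k X ∣ C k
size≤∣cover∣Ck {m} {k} {X} kX = begin
  size X                        ≤⟨ count-mono X⊆kSubsets (allSubsets m) ⟩
  size (kSubsetsOf (cover k X) k) ≡⟨ size-kSubsetsOf (cover k X) k ⟩
  ∣ cover k X ∣ C k             ∎
  where
  open ≤-Reasoning
  X⊆kSubsets : ∀ s → X s ≡ true → kSubsetsOf (cover k X) k s ≡ true
  X⊆kSubsets s Xs = cong₂ _∧_ (∣s∣≡ᵇk kX Xs) (dec-true (s ⊆? cover k X) (⊆-cover kX Xs))

meets-star : ∀ {m} k (i : Fin m) X Y → meets (starRect k i) X Y ≡ lookup (cover k X ∩ cover k Y) i
meets-star k i X Y = sym (trans (lookup-zipWith _∧_ i (cover k X) (cover k Y))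
  (cong₂ _∧_ (lookup∘tabulate _ i) (lookup∘tabulate _ i)))

star-isZeroMonoRect : ∀ {m} k (i : Fin m) → IsZeroMonoRect k (starRect k i)
star-isZeroMonoRect k i = star-isKFamily , star-isKFamily , disjoint
  where
  star-isKFamily : IsKFamily k (star k i)
  star-isKFamily a eq = ≡ᵇ⇒≡ ∣ a ∣ k (Equivalence.from T-≡ (∧-conicalʳ _ _ eq))
  ∈-star : ∀ c → star k i c ≡ true → i ∈ c
  ∈-star c ic = lookup⇒[]= i c (∧-conicalˡ _ _ ic)
  disjoint : ∀ a b → star k i a ≡ true → star k i b ≡ true → DISJ a b ≡ 0
  disjoint a b ia ib rewrite dec-true (nonempty? (a ∩ b)) (i , x∈p∩q⁺ (∈-star a ia , ∈-star b ib)) = refl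

∣p∣+∣q∣≤∣p∩q∣+n : ∀ {n} (p q : Subset n) → ∣ p ∣ + ∣ q ∣ ≤ ∣ p ∩ q ∣ + n
∣p∣+∣q∣≤∣p∩q∣+n [] [] = z≤n
∣p∣+∣q∣≤∣p∩q∣+n {suc n} (outside ∷ p) (outside ∷ q) =
  ≤-trans (∣p∣+∣q∣≤∣p∩q∣+n p q) (+-monoʳ-≤ ∣ p ∩ q ∣ (n≤1+n n))
∣p∣+∣q∣≤∣p∩q∣+n {suc n} (inside ∷ p) (outside ∷ q) =
  ≤-trans (s≤s (∣p∣+∣q∣≤∣p∩q∣+n p q)) (≤-reflexive (sym (+-suc ∣ p ∩ q ∣ n)))
∣p∣+∣q∣≤∣p∩q∣+n {suc n} (outside ∷ p) (inside ∷ q) =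
  subst₂ _≤_ (sym (+-suc ∣ p ∣ ∣ q ∣)) (sym (+-suc ∣ p ∩ q ∣ n)) (s≤s (∣p∣+∣q∣≤∣p∩q∣+n p q))
∣p∣+∣q∣≤∣p∩q∣+n {suc n} (inside ∷ p) (inside ∷ q) =
  s≤s (subst₂ _≤_ (sym (+-suc ∣ p ∣ ∣ q ∣)) (sym (+-suc ∣ p ∩ q ∣ n)) (s≤s (∣p∣+∣q∣≤∣p∩q∣+n p q)))

9n≤c*10 : ∀ {n u v c} → 19 * n ≤ 20 * u → 19 * n ≤ 20 * v → u + v ≤ c + n → 9 * n ≤ c * 10
9n≤c*10 {n} {u} {v} {c} 19n≤20u 19n≤20v u+v≤c+n = *-cancelˡ-≤ 2 (+-cancelʳ-≤ (20 * n) _ _ (begin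
  2 * (9 * n) + 20 * n     ≡⟨ 18+20≡19+19 n ⟩
  19 * n + 19 * n          ≤⟨ +-mono-≤ 19n≤20u 19n≤20v ⟩
  20 * u + 20 * v          ≡⟨ *-distribˡ-+ 20 u v ⟨
  20 * (u + v)             ≤⟨ *-monoʳ-≤ 20 u+v≤c+n ⟩
  20 * (c + n)             ≡⟨ *-distribˡ-+ 20 c n ⟩
  20 * c + 20 * n          ≡⟨ cong (_+ 20 * n) (20c≡2[c*10] c) ⟩
  2 * (c * 10) + 20 * n    ∎))
  where
  open ≤-Reasoning
  18+20≡19+19 : ∀ n → 2 * (9 * n) + 20 * n ≡ 19 * n + 19 * n
  18+20≡19+19 = solve-∀
  20c≡2[c*10] : ∀ c → 20 * c ≡ 2 * (c * 10)
  20c≡2[c*10] = solve-∀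

toℚᵘ-/ : ∀ a d → toℚᵘ (+ a / suc d) ℚᵘ.≃ mkℚᵘ (+ a) d
toℚᵘ-/ a d = ℚ.toℚᵘ-fromℚᵘ (mkℚᵘ (+ a) d)

a/n+b/n≡[a+b]/n : ∀ a b d → + a / suc d ℚ.+ + b / suc d ≡ + (a + b) / suc d
a/n+b/n≡[a+b]/n a b d = ℚ.toℚᵘ-injective (begin
  toℚᵘ (+ a / suc d ℚ.+ + b / suc d)         ≈⟨ ℚ.toℚᵘ-homo-+ (+ a / suc d) (+ b / suc d) ⟩
  toℚᵘ (+ a / suc d) ℚᵘ.+ toℚᵘ (+ b / suc d)  ≈⟨ ℚᵘ.+-cong (toℚᵘ-/ a d) (toℚᵘ-/ b d) ⟩
  mkℚᵘ (+ a) d ℚᵘ.+ mkℚᵘ (+ b) d              ≈⟨ *≡* (trans (distrib (+ a) (+ b) (+ suc d)) (cong (ℤ._* (+ suc d ℤ.* + suc d)) (sym (ℤ.pos-+ a b)))) ⟩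
  mkℚᵘ (+ (a + b)) d                        ≈⟨ toℚᵘ-/ (a + b) d ⟨
  toℚᵘ (+ (a + b) / suc d)                  ∎)
  where
  open ℚᵘ.≃-Reasoning
  distrib : ∀ x y n → (x ℤ.* n ℤ.+ y ℤ.* n) ℤ.* n ≡ (x ℤ.+ y) ℤ.* (n ℤ.* n)
  distrib x y n = trans (cong (ℤ._* n) (sym (ℤ.*-distribʳ-+ n x y))) (ℤ.*-assoc (x ℤ.+ y) n n)

n/n≡1 : ∀ d → + suc d / suc d ≡ 1ℚ
n/n≡1 d = ℚ.toℚᵘ-injective (ℚᵘ.≃-trans (toℚᵘ-/ (suc d) d) (*≡* (ℤ.*-comm (+ suc d) (+ 1))))

a*d≤c*b⇒a/b≤c/d : ∀ a b c d → a * suc d ≤ c * suc b → + a / suc b ℚ.≤ + c / suc d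
a*d≤c*b⇒a/b≤c/d a b c d ad≤cb = ℚ.toℚᵘ-cancel-≤
  (ℚᵘ.≤-respˡ-≃ (ℚᵘ.≃-sym (toℚᵘ-/ a b)) (ℚᵘ.≤-respʳ-≃ (ℚᵘ.≃-sym (toℚᵘ-/ c d))
    (*≤* (subst₂ ℤ._≤_ (ℤ.pos-* a (suc d)) (ℤ.pos-* c (suc b)) (+≤+ ad≤cb)))))

toℚᵘ-1/n*k : ∀ k d → toℚᵘ (+ 1 / suc d ℚ.* (+ k / 1)) ℚᵘ.≃ mkℚᵘ (+ k) d
toℚᵘ-1/n*k k d = begin
  toℚᵘ (+ 1 / suc d ℚ.* (+ k / 1))        ≈⟨ ℚ.toℚᵘ-homo-* (+ 1 / suc d) (+ k / 1) ⟩
  toℚᵘ (+ 1 / suc d) ℚᵘ.* toℚᵘ (+ k / 1)  ≈⟨ ℚᵘ.*-cong (toℚᵘ-/ 1 d) (toℚᵘ-/ k 0) ⟩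
  mkℚᵘ (+ 1) d ℚᵘ.* mkℚᵘ (+ k) 0          ≈⟨ *≡* (trans (cong (ℤ._* + suc d) (ℤ.*-identityˡ (+ k)))
                                                        (cong (λ n → + k ℤ.* + n) (sym (*-identityʳ (suc d))))) ⟩
  mkℚᵘ (+ k) d                            ∎
  where open ℚᵘ.≃-Reasoning

n*∣floor[1/n*k]∣≤k : ∀ k d → suc d * ℤ.∣ floor (+ 1 / suc d ℚ.* (+ k / 1)) ∣ ≤ k
n*∣floor[1/n*k]∣≤k k d = bound (+ 1 / suc d ℚ.* (+ k / 1)) (toℚᵘ-1/n*k k d)
  where
  bound : ∀ q → toℚᵘ q ℚᵘ.≃ mkℚᵘ (+ k) d → suc d * ℤ.∣ floor q ∣ ≤ k
  bound q@(mkℚ (+ a) e _) (*≡* a*n≡k*e) = *-cancelʳ-≤ (suc d * ℤ.∣ floor q ∣) k (suc e) (begin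
    suc d * ℤ.∣ floor q ∣ * suc e  ≡⟨ cong (λ z → suc d * ℤ.∣ z ∣ * suc e) (div-pos-is-/ℕ (+ a) (suc e)) ⟩
    suc d * (a ℕ./ suc e) * suc e  ≡⟨ rearrange (suc d) (a ℕ./ suc e) (suc e) ⟩
    a ℕ./ suc e * suc e * suc d    ≤⟨ *-monoˡ-≤ (suc d) (m/n*n≤m a (suc e)) ⟩
    a * suc d                      ≡⟨ ℤ.+-injective (trans (ℤ.pos-* a (suc d)) (trans a*n≡k*e (sym (ℤ.pos-* k (suc e))))) ⟩
    k * suc e                      ∎)
    where
    open ≤-Reasoning
    rearrange : ∀ x y z → x * y * z ≡ y * z * x
    rearrange = solve-∀
  bound (mkℚ -[1+ a ] e _) (*≡* eq) with trans eq (sym (ℤ.pos-* k (suc e)))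
  ... | ()

uniform : ∀ {m n} → ℚ → (Fin n → Rectangle m) → Dist m
uniform w R = List.tabulate (λ i → w , R i)

totalWeight-uniform : ∀ {m n} d (R : Fin n → Rectangle m) → totalWeight (uniform (+ 1 / suc d) R) ≡ + n / suc d
totalWeight-uniform {n = zero} d R = sym (ℚ.0/n≡0 (suc d))
totalWeight-uniform {n = suc n} d R =
  trans (cong (+ 1 / suc d ℚ.+_) (totalWeight-uniform d (R ∘ suc))) (a/n+b/n≡[a+b]/n 1 n d)

probMeets-uniform : ∀ {m n} d (R : Fin n → Rectangle m) X Y →
  probMeets (uniform (+ 1 / suc d) R) X Y ≡ + ∣ tabulate (λ i → meets (R i) X Y) ∣ / suc d
probMeets-uniform {n = zero} d R X Y = sym (ℚ.0/n≡0 (suc d))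
probMeets-uniform {n = suc n} d R X Y with meets (R zero) X Y
... | true = trans (cong (+ 1 / suc d ℚ.+_) (probMeets-uniform d (R ∘ suc) X Y))
                 (a/n+b/n≡[a+b]/n 1 ∣ tabulate (λ i → meets (R (suc i)) X Y) ∣ d)
... | false = trans (cong₂ ℚ._+_ (sym (ℚ.0/n≡0 (suc d))) (probMeets-uniform d (R ∘ suc) X Y))
                  (a/n+b/n≡[a+b]/n 0 ∣ tabulate (λ i → meets (R (suc i)) X Y) ∣ d)

uniform-isProbDist : ∀ {m} d (R : Fin (suc d) → Rectangle m) → IsProbDist (uniform (+ 1 / suc d) R)
uniform-isProbDist d R =
  tabulate⁺ {f = λ i → + 1 / suc d , R i} (λ _ → a*d≤c*b⇒a/b≤c/d 0 0 1 d z≤n) ,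
  trans (totalWeight-uniform d R) (n/n≡1 d)

uniform-overZeroMono : ∀ {m n} k w (R : Fin n → Rectangle m) →
                       (∀ i → IsZeroMonoRect k (R i)) → OverZeroMono k (uniform w R)
uniform-overZeroMono k w R R-zeroMono = tabulate⁺ {f = λ i → w , R i} R-zeroMono

starDist : ∀ d → ℕ → Dist (suc d)
starDist d k = uniform (+ 1 / suc d) (starRect k)

probMeets-starDist : ∀ d k X Y → probMeets (starDist d k) X Y ≡ + ∣ cover k X ∩ cover k Y ∣ / suc d
probMeets-starDist d k X Y = trans (probMeets-uniform d (starRect {suc d} k) X Y)
  (cong (λ p → + ∣ p ∣ / suc d) (trans (tabulate-cong (λ i → meets-star k i X Y)) (tabulate∘lookup (cover k X ∩ cover k Y))))

cover-large : ∀ {m k} h {X : Family m} → IsKFamily k X → 0 < k → k ≤ m → 14 * h ≤ k →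
              m C k ≤ 2 ^ h * size X → 19 * m ≤ 20 * ∣ cover k X ∣
cover-large {k = k} h {X} kX 0<k k≤m 14h≤k mCk≤2^h|X| = 19m≤20u h 0<k 14h≤k
  (m^k≤2^h*u^k h k≤m (∣p∣≤n (cover k X)) (≤-trans mCk≤2^h|X| (*-monoʳ-≤ (2 ^ h) (size≤∣cover∣Ck kX))))

starDist-isHitting : ∀ d k h → 0 < k → k ≤ suc d → 14 * h ≤ k → IsHitting (suc d) k (+ 1 / 10) h (starDist d k)
starDist-isHitting d k h 0<k k≤m 14h≤k X Y kX kY dense-X dense-Y = begin
  1ℚ ℚ.- + 1 / 10                       ≡⟨⟩
  + 9 / 10                              ≤⟨ a*d≤c*b⇒a/b≤c/d 9 9 ∣ cover k X ∩ cover k Y ∣ d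
                                             (9n≤c*10 {suc d} {∣ cover k X ∣} {∣ cover k Y ∣} X-large Y-large
                                               (∣p∣+∣q∣≤∣p∩q∣+n (cover k X) (cover k Y))) ⟩
  + ∣ cover k X ∩ cover k Y ∣ / suc d   ≡⟨ probMeets-starDist d k X Y ⟨
  probMeets (starDist d k) X Y          ∎
  where
  open ℚ.≤-Reasoning
  X-large : 19 * suc d ≤ 20 * ∣ cover k X ∣
  X-large = cover-large h kX 0<k k≤m 14h≤k dense-X
  Y-large : 19 * suc d ≤ 20 * ∣ cover k Y ∣
  Y-large = cover-large h kY 0<k k≤m 14h≤k dense-Y

100k<99m⇒k≤m : ∀ {k m} → 100 * k < 99 * m → k ≤ m
100k<99m⇒k≤m {k} {m} 100k<99m = *-cancelˡ-≤ 100 (≤-trans (<⇒≤ 100k<99m) (*-monoˡ-≤ m (≤ᵇ⇒≤ 99 100 _)))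

proposition5 : Σ ℚ λ c → Positive c × Σ ℕ λ m₀ →
    ∀ (m k : ℕ) → m₀ ≤ m → 0 < k → 100 * k < 99 * m →
    Σ (Dist m) λ D → IsProbDist D × OverZeroMono k D ×
      IsHitting m k (+ 1 / 10) ℤ.∣ floor (c ℚ.* (+ k / 1)) ∣ D
proposition5 = + 1 / 14 , _ , 1 , λ where
  (suc d) k _ 0<k 100k<99m →
    starDist d k , uniform-isProbDist d (starRect k) ,
    uniform-overZeroMono k _ (starRect k) (star-isZeroMonoRect k) ,
    starDist-isHitting d k ℤ.∣ floor (+ 1 / 14 ℚ.* (+ k / 1)) ∣ 0<k (100k<99m⇒k≤m 100k<99m)
      (n*∣floor[1/n*k]∣≤k k 13)
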